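{- Let $T$ be an optimal basic tree (for the displacement sequence it represents). Then $T$ contains at most one $\mathsf{idx}$ node with count $1$, i.e. at most one node of the form $N=\mathsf{idx}(1,\langle i_0\rangle,C)$; moreover, if such a node $N$ exists, there is no other $\mathsf{idx}$ or $\mathsf{strc}$ node on the path from $N$ to the root.
   Context: A displacement sequence is a finite sequence of integers. A basic tree is a rooted ordered tree whose nodes are of four kinds: a leaf $\mathsf{con}(c)$; $\mathsf{vec}(c,d,C)$ (count $c$, stride $d$, one child $C$); $\mathsf{idx}(c,\langle i_0,\dots,i_{c-1}\rangle,C)$ (one child); $\mathsf{strc}(c,\langle i_0,\dots,i_{c-1}\rangle,\langle C_0,\dots,C_{c-1}\rangle)$ ($c$ children). With $S+x$ denoting $S$ with $x$ added to each entry, the represented sequence is defined recursively: $\mathrm{Flat}(\mathsf{con}(c))=\langle 0,\dots,c-1\rangle$; $\mathrm{Flat}(\mathsf{vec}(c,d,C))=$ concatenation of $\mathrm{Flat}(C)+kd$, $k=0,\dots,c-1$; $\mathrm{Flat}(\mathsf{idx}(c,\langle i_k\rangle,C))=$ concatenation of $\mathrm{Flat}(C)+i_k$; $\mathrm{Flat}(\mathsf{strc}(c,\langle i_k\rangle,\langle C_k\rangle))=$ concatenation of $\mathrm{Flat}(C_k)+i_k$. $T$ represents $D$ if $\mathrm{Flat}(T)=D$. Costs (fixed positive constants $K$): $\mathrm{cost}(\mathsf{con})=K_{\mathsf{con}}$, $\mathrm{cost}(\mathsf{vec})=K_{\mathsf{vec}}$, $\mathrm{cost}(\mathsf{idx}(c,\dots))=K_{\mathsf{idx}}+cK_{\mathrm{lookup}}$,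 $\mathrm{cost}(\mathsf{strc}(c,\dots))=K_{\mathsf{strc}}+2cK_{\mathrm{lookup}}$; tree cost is the sum of node costs. A basic tree $T$ is optimal for $D$ if it represents $D$ and has minimum cost among all basic trees representing $D$.
   Formalization: The fixed cost constants K (for con, vec, idx, strc and lookup) are taken to be positive rationals. -}

module Defs where

open import Data.Nat as ℕ using (ℕ)
open import Data.Integer as ℤ using (ℤ; +_)
open import Data.Rational as ℚ using (ℚ; 0ℚ)
open import Data.Fin using (Fin; zero; suc)
open import Data.Vec using (Vec; []; _∷_; lookup)
open import Data.List using (List; []; _∷_; _++_; map; upTo; concat)
open import Data.Product using (_×_)
open import Relation.Binary.PropositionalEquality using (_≡_)
open import Relation.Nullary using (¬_)

data BasicTree : Set where
  con  : (c : ℕ) → BasicTree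
  vec  : (c : ℕ) (d : ℤ) (C : BasicTree) → BasicTree
  idx  : (c : ℕ) (is : Vec ℤ c) (C : BasicTree) → BasicTree
  strc : (c : ℕ) (is : Vec ℤ c) (Cs : Vec BasicTree c) → BasicTree

shift : List ℤ → ℤ → List ℤ
shift S x = map (ℤ._+ x) S

mutual
  Flat : BasicTree → List ℤ
  Flat (con c)        = map +_ (upTo c)
  Flat (vec c d C)    = concat (map (λ k → shift (Flat C) ((+ k) ℤ.* d)) (upTo c))
  Flat (idx c is C)   = concatIdx (Flat C) is
  Flat (strc c is Cs) = flatStrc is Cs

  flatStrc : ∀ {c} → Vec ℤ c → Vec BasicTree c → List ℤ
  flatStrc []       []       = []
  flatStrc (i ∷ is) (C ∷ Cs) = shift (Flat C) i ++ flatStrc is Cs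

  concatIdx : ∀ {c} → List ℤ → Vec ℤ c → List ℤ
  concatIdx S []       = []
  concatIdx S (i ∷ is) = shift S i ++ concatIdx S is

Represents : BasicTree → List ℤ → Set
Represents T D = Flat T ≡ D

record Costs : Set where
  field
    Kcon Kvec Kidx Kstrc Klookup : ℚ
    Kcon>0    : 0ℚ ℚ.< Kcon
    Kvec>0    : 0ℚ ℚ.< Kvec
    Kidx>0    : 0ℚ ℚ.< Kidx
    Kstrc>0   : 0ℚ ℚ.< Kstrc
    Klookup>0 : 0ℚ ℚ.< Klookup

fromℕ : ℕ → ℚ
fromℕ c = (+ c) ℚ./ 1

module _ (K : Costs) where
  open Costs K

  mutual
    cost : BasicTree → ℚ
    cost (con c)        = Kcon
    cost (vec c d C)    = Kvec ℚ.+ cost C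
    cost (idx c is C)   = (Kidx ℚ.+ fromℕ c ℚ.* Klookup) ℚ.+ cost C
    cost (strc c is Cs) = (Kstrc ℚ.+ fromℕ (2 ℕ.* c) ℚ.* Klookup) ℚ.+ costs Cs

    costs : ∀ {c} → Vec BasicTree c → ℚ
    costs []       = 0ℚ
    costs (C ∷ Cs) = cost C ℚ.+ costs Cs

  Optimal : BasicTree → List ℤ → Set
  Optimal T D = Represents T D × (∀ T′ → Represents T′ D → cost T ℚ.≤ cost T′)

data Pos : BasicTree → Set where
  here  : ∀ {T} → Pos T
  vecP  : ∀ {c d C} → Pos C → Pos (vec c d C)
  idxP  : ∀ {c is C} → Pos C → Pos (idx c is C)
  strcP : ∀ {c is Cs} (k : Fin c) → Pos (lookup Cs k) → Pos (strc c is Cs)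

at : ∀ {T} → Pos T → BasicTree
at {T} here       = T
at (vecP p)       = at p
at (idxP p)       = at p
at (strcP k p)    = at p

data _≺_ : ∀ {T} → Pos T → Pos T → Set where
  here≺  : ∀ {c d C} {q : Pos C} → here ≺ vecP {c} {d} q
  here≺i : ∀ {c is C} {q : Pos C} → here ≺ idxP {c} {is} q
  here≺s : ∀ {c is Cs} {k : Fin c} {q : Pos (lookup Cs k)} → here ≺ strcP {c} {is} {Cs} k q
  vec≺   : ∀ {c d C} {p q : Pos C} → p ≺ q → vecP {c} {d} p ≺ vecP q
  idx≺   : ∀ {c is C} {p q : Pos C} → p ≺ q → idxP {c} {is} p ≺ idxP q
  strc≺  : ∀ {c is Cs} {k : Fin c} {p q : Pos (lookup Cs k)} → p ≺ q → strcP {c} {is} {Cs} k p ≺ strcP k q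

data IsIdx1 : BasicTree → Set where
  isIdx1 : ∀ i₀ C → IsIdx1 (idx 1 (i₀ ∷ []) C)

data IsIdxOrStrc : BasicTree → Set where
  isIdx  : ∀ c is C  → IsIdxOrStrc (idx c is C)
  isStrc : ∀ c is Cs → IsIdxOrStrc (strc c is Cs)

module Submission where

-- An idx node of count 1, N = idx(1,⟨i₀⟩,C), only displaces the
-- sequence of its child C by i₀, at the price δ = K_idx + K_lookup.
--  * Unwrapping: deleting such a node anywhere in a tree X yields a tree X′ of
--    cost cost X − δ whose sequence is Flat X displaced by some offset j.
--    A vec or idx node above the deleted node passes the offset upwards
--    (displacing a child commutes with concatenating its copies); a strc node
--    absorbs it into the index of the affected child.
--  * Improvement: if an idx or strc node lies above N, unwrap N inside its
--    child and absorb the offset into that node's index (indices); the result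
--    represents the same sequence and is cheaper by δ > 0.  Hence in an optimal
--    tree no idx/strc node lies above an idx(1) node (second claim).
--  * Two distinct idx(1) nodes either lie on a common path, or their paths
--    branch at a strc node; either way one of them has an idx or strc proper
--    ancestor, so the second claim implies the first.

open import Defs
open import Data.Product using (_×_; _,_)
open import Relation.Binary.PropositionalEquality
  using (_≡_; refl; sym; trans; cong; cong₂; subst; module ≡-Reasoning)
open import Relation.Nullary using (¬_)
open import Data.Empty using (⊥-elim)
import Data.Nat as ℕ
open import Data.Integer as ℤ using (ℤ; +_)
import Data.Integer.Properties as ℤP
open import Data.Rational as ℚ using (ℚ; 0ℚ)
import Data.Rational.Properties as ℚP
open import Data.Fin using (zero; suc)
open import Data.Vec as Vec using (Vec; []; _∷_; lookup; _[_]%=_; _[_]≔_)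
open import Data.List using (List; []; _∷_; _++_; map; concat; upTo)
import Data.List.Properties as ListP

shift-++ : ∀ (A B : List ℤ) j → shift (A ++ B) j ≡ shift A j ++ shift B j
shift-++ A B j = ListP.map-++ (ℤ._+ j) A B

shift-shift : ∀ (S : List ℤ) a b → shift (shift S a) b ≡ shift S (a ℤ.+ b)
shift-shift S a b = trans (sym (ListP.map-∘ S)) (ListP.map-cong (λ x → ℤP.+-assoc x a b) S)

shift-zero : ∀ (S : List ℤ) → shift S (+ 0) ≡ S
shift-zero S = trans (ListP.map-cong ℤP.+-identityʳ S) (ListP.map-id S)

shift-comm : ∀ (S : List ℤ) a b → shift (shift S a) b ≡ shift (shift S b) a
shift-comm S a b = begin
  shift (shift S a) b  ≡⟨ shift-shift S a b ⟩
  shift S (a ℤ.+ b)    ≡⟨ cong (shift S) (ℤP.+-comm a b) ⟩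
  shift S (b ℤ.+ a)    ≡⟨ sym (shift-shift S b a) ⟩
  shift (shift S b) a  ∎
  where open ≡-Reasoning

concat-shifted : ∀ {A : Set} (F : List ℤ) j (f : A → ℤ) (L : List A) →
  concat (map (λ k → shift (shift F j) (f k)) L) ≡ shift (concat (map (λ k → shift F (f k)) L)) j
concat-shifted F j f [] = refl
concat-shifted F j f (k ∷ L) =
  trans (cong₂ _++_ (shift-comm F j (f k)) (concat-shifted F j f L))
        (sym (shift-++ (shift F (f k)) _ j))

concatIdx-shift-out : ∀ {c} (F : List ℤ) j (is : Vec ℤ c) →
  concatIdx (shift F j) is ≡ shift (concatIdx F is) j
concatIdx-shift-out F j [] = refl
concatIdx-shift-out F j (i ∷ is) =
  trans (cong₂ _++_ (shift-comm F j i) (concatIdx-shift-out F j is))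
        (sym (shift-++ (shift F i) _ j))

concatIdx-absorb : ∀ {c} (F : List ℤ) j (is : Vec ℤ c) →
  concatIdx (shift F j) is ≡ concatIdx F (Vec.map (ℤ._+_ j) is)
concatIdx-absorb F j [] = refl
concatIdx-absorb F j (i ∷ is) = cong₂ _++_ (shift-shift F j i) (concatIdx-absorb F j is)

flatStrc-absorb : ∀ {c} (is : Vec ℤ c) (Cs : Vec BasicTree c) k C′ j →
  Flat (lookup Cs k) ≡ shift (Flat C′) j →
  flatStrc is Cs ≡ flatStrc (is [ k ]%= (ℤ._+_ j)) (Cs [ k ]≔ C′)
flatStrc-absorb (i ∷ is) (C ∷ Cs) zero C′ j eq =
  cong (_++ flatStrc is Cs) (trans (cong (λ S → shift S i) eq) (shift-shift (Flat C′) j i))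
flatStrc-absorb (i ∷ is) (C ∷ Cs) (suc k) C′ j eq =
  cong (shift (Flat C) i ++_) (flatStrc-absorb is Cs k C′ j eq)

flatStrc-replace : ∀ {c} (is : Vec ℤ c) (Cs : Vec BasicTree c) k C′ →
  Flat (lookup Cs k) ≡ Flat C′ → flatStrc is Cs ≡ flatStrc is (Cs [ k ]≔ C′)
flatStrc-replace (i ∷ is) (C ∷ Cs) zero C′ eq = cong (λ S → shift S i ++ flatStrc is Cs) eq
flatStrc-replace (i ∷ is) (C ∷ Cs) (suc k) C′ eq =
  cong (shift (Flat C) i ++_) (flatStrc-replace is Cs k C′ eq)

-- Descending along vec nodes, two distinct positions either
-- reach an idx(1) node above the other one, or split at a strc node.
ancestor-free⇒unique : ∀ {T} →
  ((p q : Pos T) → IsIdx1 (at q) → p ≺ q → ¬ IsIdxOrStrc (at p)) →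
  (p q : Pos T) → IsIdx1 (at p) → IsIdx1 (at q) → p ≡ q
ancestor-free⇒unique H here        here        hp hq = refl
ancestor-free⇒unique H here        (vecP q)    () hq
ancestor-free⇒unique H here        (idxP q)    hp hq = ⊥-elim (H here (idxP q) hq here≺i (isIdx _ _ _))
ancestor-free⇒unique H here        (strcP k q) () hq
ancestor-free⇒unique H (vecP p)    here        hp ()
ancestor-free⇒unique H (idxP p)    here        hp hq = ⊥-elim (H here (idxP p) hp here≺i (isIdx _ _ _))
ancestor-free⇒unique H (strcP k p) here        hp ()
ancestor-free⇒unique H (vecP p)    (vecP q)    hp hq =
  cong vecP (ancestor-free⇒unique (λ p′ q′ h lt → H (vecP p′) (vecP q′) h (vec≺ lt)) p q hp hq)
ancestor-free⇒unique H (idxP p)    (idxP q)    hp hq = ⊥-elim (H here (idxP q) hq here≺i (isIdx _ _ _))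
ancestor-free⇒unique H (strcP k p) (strcP l q) hp hq = ⊥-elim (H here (strcP l q) hq here≺s (isStrc _ _ _))

module Transformations (K : Costs) where
  open Costs K

  saving-under : ∀ a {x y e} → x ≡ y ℚ.+ e → a ℚ.+ x ≡ (a ℚ.+ y) ℚ.+ e
  saving-under a {x} {y} {e} eq = trans (cong (a ℚ.+_) eq) (sym (ℚP.+-assoc a y e))

  costs-update : ∀ {c e} (Cs : Vec BasicTree c) k C′ →
    cost K (lookup Cs k) ≡ cost K C′ ℚ.+ e → costs K Cs ≡ costs K (Cs [ k ]≔ C′) ℚ.+ e
  costs-update {e = e} (C ∷ Cs) zero C′ eq = begin
    cost K C ℚ.+ costs K Cs          ≡⟨ cong (ℚ._+ costs K Cs) eq ⟩
    (cost K C′ ℚ.+ e) ℚ.+ costs K Cs ≡⟨ ℚP.+-assoc (cost K C′) e (costs K Cs) ⟩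
    cost K C′ ℚ.+ (e ℚ.+ costs K Cs) ≡⟨ cong (cost K C′ ℚ.+_) (ℚP.+-comm e (costs K Cs)) ⟩
    cost K C′ ℚ.+ (costs K Cs ℚ.+ e) ≡⟨ sym (ℚP.+-assoc (cost K C′) (costs K Cs) e) ⟩
    (cost K C′ ℚ.+ costs K Cs) ℚ.+ e ∎
    where open ≡-Reasoning
  costs-update (C ∷ Cs) (suc k) C′ eq = saving-under (cost K C) (costs-update Cs k C′ eq)

  -- Cost of an idx node of count 1 (without its child).
  δ : ℚ
  δ = Kidx ℚ.+ fromℕ 1 ℚ.* Klookup

  δ>0 : 0ℚ ℚ.< δ
  δ>0 = subst (ℚ._< δ) (ℚP.+-identityˡ 0ℚ)
    (ℚP.+-mono-< Kidx>0 (subst (0ℚ ℚ.<_) (sym (ℚP.*-identityˡ Klookup)) Klookup>0))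

  -- X with one idx(1) node deleted: a tree cheaper by δ whose sequence,
  -- displaced by some offset, is that of X.
  record Unwrapping (X : BasicTree) : Set where
    constructor unwrapping
    field
      core      : BasicTree
      offset    : ℤ
      flat-core : Flat X ≡ shift (Flat core) offset
      cost-core : cost K X ≡ cost K core ℚ.+ δ

  unwrap : ∀ X (r : Pos X) → IsIdx1 (at r) → Unwrapping X
  unwrap .(idx 1 (i ∷ []) C) here (isIdx1 i C) =
    unwrapping C i (ListP.++-identityʳ _) (ℚP.+-comm _ (cost K C))
  unwrap (vec c d C) (vecP r) h with unwrap C r h
  ... | unwrapping C′ j fe ce = unwrapping (vec c d C′) j
    (trans (cong (λ F → concat (map (λ k → shift F ((+ k) ℤ.* d)) (upTo c))) fe)
           (concat-shifted (Flat C′) j (λ k → (+ k) ℤ.* d) (upTo c)))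
    (saving-under Kvec ce)
  unwrap (idx c is C) (idxP r) h with unwrap C r h
  ... | unwrapping C′ j fe ce = unwrapping (idx c is C′) j
    (trans (cong (λ F → concatIdx F is) fe) (concatIdx-shift-out (Flat C′) j is))
    (saving-under (Kidx ℚ.+ fromℕ c ℚ.* Klookup) ce)
  unwrap (strc c is Cs) (strcP k r) h with unwrap (lookup Cs k) r h
  ... | unwrapping C′ j fe ce = unwrapping (strc c (is [ k ]%= (ℤ._+_ j)) (Cs [ k ]≔ C′)) (+ 0)
    (trans (flatStrc-absorb is Cs k C′ j fe) (sym (shift-zero _)))
    (saving-under (Kstrc ℚ.+ fromℕ (2 ℕ.* c) ℚ.* Klookup) (costs-update Cs k C′ ce))

  record Improvement (X : BasicTree) : Set where
    constructor improvement
    field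
      better      : BasicTree
      flat-better : Flat X ≡ Flat better
      cost-better : cost K X ≡ cost K better ℚ.+ δ

  -- An idx or strc node above an idx(1) node allows an improvement: unwrap
  -- below it and absorb the offset into the indices at the ancestor.
  improve : ∀ {X} (p r : Pos X) → IsIdx1 (at r) → p ≺ r → IsIdxOrStrc (at p) → Improvement X
  improve .here .(vecP _) h here≺ ()
  improve {idx c is C} .here (idxP r) h here≺i _ with unwrap C r h
  ... | unwrapping C′ j fe ce = improvement (idx c (Vec.map (ℤ._+_ j) is) C′)
    (trans (cong (λ F → concatIdx F is) fe) (concatIdx-absorb (Flat C′) j is))
    (saving-under (Kidx ℚ.+ fromℕ c ℚ.* Klookup) ce)
  improve {strc c is Cs} .here (strcP k r) h here≺s _ with unwrap (lookup Cs k) r h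
  ... | unwrapping C′ j fe ce = improvement (strc c (is [ k ]%= (ℤ._+_ j)) (Cs [ k ]≔ C′))
    (flatStrc-absorb is Cs k C′ j fe)
    (saving-under (Kstrc ℚ.+ fromℕ (2 ℕ.* c) ℚ.* Klookup) (costs-update Cs k C′ ce))
  improve {vec c d C} (vecP p) (vecP r) h (vec≺ lt) a with improve p r h lt a
  ... | improvement C′ fe ce = improvement (vec c d C′)
    (cong (λ F → concat (map (λ k → shift F ((+ k) ℤ.* d)) (upTo c))) fe)
    (saving-under Kvec ce)
  improve {idx c is C} (idxP p) (idxP r) h (idx≺ lt) a with improve p r h lt a
  ... | improvement C′ fe ce = improvement (idx c is C′)
    (cong (λ F → concatIdx F is) fe)
    (saving-under (Kidx ℚ.+ fromℕ c ℚ.* Klookup) ce)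
  improve {strc c is Cs} (strcP k p) (strcP k r) h (strc≺ lt) a with improve p r h lt a
  ... | improvement C′ fe ce = improvement (strc c is (Cs [ k ]≔ C′))
    (flatStrc-replace is Cs k C′ fe)
    (saving-under (Kstrc ℚ.+ fromℕ (2 ℕ.* c) ℚ.* Klookup) (costs-update Cs k C′ ce))

  optimal⇒no-improvement : ∀ {T D} → Optimal K T D → Flat T ≡ D → ¬ Improvement T
  optimal⇒no-improvement {T} (_ , minimal) refl (improvement T′ fe ce) =
    ℚP.<-irrefl refl (ℚP.<-≤-trans T′<T (minimal T′ (sym fe)))
    where
      T′<T : cost K T′ ℚ.< cost K T
      T′<T = subst (ℚ._< cost K T) (ℚP.+-identityʳ (cost K T′))
               (subst (cost K T′ ℚ.+ 0ℚ ℚ.<_) (sym ce) (ℚP.+-monoʳ-< (cost K T′) δ>0))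

corollary1 : (K : Costs) (T : BasicTree) → Optimal K T (Flat T) →
    ((p q : Pos T) → IsIdx1 (at p) → IsIdx1 (at q) → p ≡ q)
    × ((p q : Pos T) → IsIdx1 (at q) → p ≺ q → ¬ IsIdxOrStrc (at p))
corollary1 K T opt = ancestor-free⇒unique ancestor-free , ancestor-free
  where
    open Transformations K
    ancestor-free : (p q : Pos T) → IsIdx1 (at q) → p ≺ q → ¬ IsIdxOrStrc (at p)
    ancestor-free p q h p≺q a = optimal⇒no-improvement opt refl (improve p q h p≺q a)
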